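{- For all FEL-terms $P, Q \in \mathrm{FT}$: if $\mathrm{EqFFEL} \vdash P = Q$, then $\mathrm{fe}(P) = \mathrm{fe}(Q)$ (i.e. $\mathrm{FFEL} \vDash P = Q$).
   Context: Let $A$ be a countable set of atoms. The set $\mathrm{FT}$ of FEL-terms is generated by $P ::= a \ (a \in A) \mid \mathsf{T} \mid \mathsf{F} \mid \neg P \mid (P \wedge^{\bullet} P) \mid (P \vee^{\bullet} P)$, where $\wedge^{\bullet}$ and $\vee^{\bullet}$ denote full left-sequential conjunction and disjunction. Let $\mathcal{T}$ be the set of finite binary trees given by: $\mathsf{T}, \mathsf{F} \in \mathcal{T}$, and $(X \trianglelefteq a \trianglerighteq Y) \in \mathcal{T}$ for $X, Y \in \mathcal{T}$, $a \in A$ (root $a$, left branch $X$, right branch $Y$). Leaf replacement is defined by $\mathsf{T}[\mathsf{T}\mapsto Y, \mathsf{F}\mapsto Z] = Y$, $\mathsf{F}[\mathsf{T}\mapsto Y, \mathsf{F}\mapsto Z] = Z$, $(X' \trianglelefteq a \trianglerighteq X'')[\mathsf{T}\mapsto Y, \mathsf{F}\mapsto Z] = X'[\mathsf{T}\mapsto Y, \mathsf{F}\mapsto Z] \trianglelefteq a \trianglerighteq X''[\mathsf{T}\mapsto Y, \mathsf{F}\mapsto Z]$; a leaf not mentioned is left unchanged (e.g. $X[\mathsf{F}\mapsto Y] = X[\mathsf{T}\mapsto \mathsf{T}, \mathsf{F}\mapsto Y]$). The full evaluation function $\mathrm{fe}: \mathrm{FT} \to \mathcal{T}$ is: $\mathrm{fe}(\mathsf{T})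 = \mathsf{T}$, $\mathrm{fe}(\mathsf{F}) = \mathsf{F}$, $\mathrm{fe}(a) = \mathsf{T} \trianglelefteq a \trianglerighteq \mathsf{F}$, $\mathrm{fe}(\neg P) = \mathrm{fe}(P)[\mathsf{T}\mapsto\mathsf{F}, \mathsf{F}\mapsto\mathsf{T}]$, $\mathrm{fe}(P \wedge^{\bullet} Q) = \mathrm{fe}(P)[\mathsf{T}\mapsto \mathrm{fe}(Q), \mathsf{F}\mapsto \mathrm{fe}(Q)[\mathsf{T}\mapsto\mathsf{F}]]$, $\mathrm{fe}(P \vee^{\bullet} Q) = \mathrm{fe}(P)[\mathsf{T}\mapsto \mathrm{fe}(Q)[\mathsf{F}\mapsto\mathsf{T}], \mathsf{F}\mapsto \mathrm{fe}(Q)]$. Free Fully Evaluated Logic is defined by $\mathrm{FFEL} \vDash P = Q$ iff $\mathrm{fe}(P) = \mathrm{fe}(Q)$. $\mathrm{EqFFEL}$ is the set of equations (in variables $x,y,z$): $\mathsf{F} = \neg\mathsf{T}$; $x \vee^{\bullet} y = \neg(\neg x \wedge^{\bullet} \neg y)$; $\neg\neg x = x$; $(x \wedge^{\bullet} y) \wedge^{\bullet} z = x \wedge^{\bullet} (y \wedge^{\bullet} z)$; $\mathsf{T} \wedge^{\bullet} x = x$; $x \wedge^{\bullet} \mathsf{T} = x$; $x \wedge^{\bullet} \mathsf{F} = \mathsf{F} \wedge^{\bullet} x$; $x \wedge^{\bullet} \mathsf{F} = \neg x \wedge^{\bullet} \mathsf{F}$; $(x \wedge^{\bullet} \mathsf{F})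 \vee^{\bullet} y = (x \vee^{\bullet} \mathsf{T}) \wedge^{\bullet} y$; $x \vee^{\bullet} (y \wedge^{\bullet} \mathsf{F}) = x \wedge^{\bullet} (y \vee^{\bullet} \mathsf{T})$. $\mathrm{EqFFEL} \vdash s = t$ means $s = t$ is derivable by equational logic from $\mathrm{EqFFEL}$. -}

module Defs where

open import Data.Nat using (ℕ)
open import Data.Fin using (Fin; zero; suc)

Atom : Set
Atom = ℕ

data Term (V : Set) : Set where
  var  : V → Term V
  atom : Atom → Term V
  `T   : Term V
  `F   : Term V
  ¬'_  : Term V → Term V
  _∧•_ : Term V → Term V → Term V
  _∨•_ : Term V → Term V → Term V

infixr 6 _∧•_
infixr 5 _∨•_
infix 7 ¬'_

data Empty : Set where

FT : Set
FT = Term Empty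

embed : {V : Set} → FT → Term V
embed (var ())
embed (atom a) = atom a
embed `T = `T
embed `F = `F
embed (¬' p) = ¬' embed p
embed (p ∧• q) = embed p ∧• embed q
embed (p ∨• q) = embed p ∨• embed q

subst : {V W : Set} → (V → Term W) → Term V → Term W
subst σ (var v) = σ v
subst σ (atom a) = atom a
subst σ `T = `T
subst σ `F = `F
subst σ (¬' p) = ¬' subst σ p
subst σ (p ∧• q) = subst σ p ∧• subst σ q
subst σ (p ∨• q) = subst σ p ∨• subst σ q

data Tree : Set where
  T : Tree
  F : Tree
  node : Tree → Atom → Tree → Tree   -- node X a Y  =  X ⊴ a ⊵ Y

replace : Tree → Tree → Tree → Tree
replace T y z = y
replace F y z = z
replace (node l a r) y z = node (replace l y z) a (replace r y z)

fe : FT → Tree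
fe (var ())
fe (atom a) = node T a F
fe `T = T
fe `F = F
fe (¬' p) = replace (fe p) F T
fe (p ∧• q) = replace (fe p) (fe q) (replace (fe q) F F)
fe (p ∨• q) = replace (fe p) (replace (fe q) T T) (fe q)

x y z : Term (Fin 3)
x = var zero
y = var (suc zero)
z = var (suc (suc zero))

data Axiom : Term (Fin 3) → Term (Fin 3) → Set where
  ax1  : Axiom `F (¬' `T)
  ax2  : Axiom (x ∨• y) (¬' ((¬' x) ∧• (¬' y)))
  ax3  : Axiom (¬' ¬' x) x
  ax4  : Axiom ((x ∧• y) ∧• z) (x ∧• (y ∧• z))
  ax5  : Axiom (`T ∧• x) x
  ax6  : Axiom (x ∧• `T) x
  ax7  : Axiom (x ∧• `F) (`F ∧• x)
  ax8  : Axiom (x ∧• `F) ((¬' x) ∧• `F)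
  ax9  : Axiom ((x ∧• `F) ∨• y) ((x ∨• `T) ∧• y)
  ax10 : Axiom (x ∨• (y ∧• `F)) (x ∧• (y ∨• `T))

data _⊢_≈_ (V : Set) : Term V → Term V → Set where
  refl'  : ∀ {s} → V ⊢ s ≈ s
  sym'   : ∀ {s t} → V ⊢ s ≈ t → V ⊢ t ≈ s
  trans' : ∀ {s t u} → V ⊢ s ≈ t → V ⊢ t ≈ u → V ⊢ s ≈ u
  inst   : ∀ {l r} → Axiom l r → (σ : Fin 3 → Term V) → V ⊢ subst σ l ≈ subst σ r
  cong¬  : ∀ {s t} → V ⊢ s ≈ t → V ⊢ (¬' s) ≈ (¬' t)
  cong∧  : ∀ {s s' t t'} → V ⊢ s ≈ s' → V ⊢ t ≈ t' → V ⊢ (s ∧• t) ≈ (s' ∧• t')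
  cong∨  : ∀ {s s' t t'} → V ⊢ s ≈ s' → V ⊢ t ≈ t' → V ⊢ (s ∨• t) ≈ (s' ∨• t')

-- Idea: fe is a compositional semantics.  Reading ¬, ∧• and ∨• as the tree
-- operations notᵗ, andᵗ, orᵗ (each a leaf replacement), fe extends to terms
-- with variables once the variables are valued in trees (⟦_⟧).  Every axiom
-- of EqFFEL then becomes an identity between trees built by leaf replacement,
-- and all of these follow from three facts about replace: it is associative
-- (replacing twice = replacing once by the replaced leaves), T/F is the
-- identity replacement, and it is congruent.  Soundness of the equational
-- calculus follows by induction on derivations (substitution commutes with
-- ⟦_⟧), and since ⟦ embed P ⟧ = fe P for closed P, an EqFFEL-derivation of
-- P = Q yields fe P ≡ fe Q.
module Submission where

open import Defs
open import Data.Fin using (Fin; zero; suc)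
open import Relation.Binary.PropositionalEquality
  using (_≡_; refl; sym; trans; cong; cong₂; module ≡-Reasoning)
open ≡-Reasoning

-- Leaf replacement is the substitution of the monad of binary trees; we
-- only need its monad laws and congruence.

replace-assoc : ∀ X Y Z Y' Z' →
  replace (replace X Y Z) Y' Z' ≡ replace X (replace Y Y' Z') (replace Z Y' Z')
replace-assoc T Y Z Y' Z' = refl
replace-assoc F Y Z Y' Z' = refl
replace-assoc (node l a r) Y Z Y' Z' =
  cong₂ (λ l' r' → node l' a r') (replace-assoc l Y Z Y' Z') (replace-assoc r Y Z Y' Z')

replace-identity : ∀ X → replace X T F ≡ X
replace-identity T = refl
replace-identity F = refl
replace-identity (node l a r) =
  cong₂ (λ l' r' → node l' a r') (replace-identity l) (replace-identity r)

replace-cong : ∀ X {Y Z Y' Z'} → Y ≡ Y' → Z ≡ Z' → replace X Y Z ≡ replace X Y' Z'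
replace-cong X refl refl = refl

notᵗ : Tree → Tree
notᵗ X = replace X F T

andᵗ : Tree → Tree → Tree
andᵗ X Y = replace X Y (replace Y F F)

orᵗ : Tree → Tree → Tree
orᵗ X Y = replace X (replace Y T T) Y

not-involutive : ∀ X → notᵗ (notᵗ X) ≡ X
not-involutive X = trans (replace-assoc X F T F T) (replace-identity X)

-- Conjunction with F collapses both outcomes of X to F; negating X first
-- makes no difference (axiom x ∧• F = ¬x ∧• F).
and-F-not : ∀ X → andᵗ (notᵗ X) F ≡ andᵗ X F
and-F-not X = replace-assoc X F T F F

-- Making every outcome T after first making it F is just making it T;
-- this is why y ∧• F followed by ∨• T is the same as y ∨• T.
or-T-after : ∀ Y → replace (replace Y F F) T T ≡ replace Y T T
or-T-after Y = replace-assoc Y F F T T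

de-morgan : ∀ X Y → orᵗ X Y ≡ notᵗ (andᵗ (notᵗ X) (notᵗ Y))
de-morgan X Y = sym (begin
  notᵗ (andᵗ (notᵗ X) (notᵗ Y))
    ≡⟨ replace-assoc (notᵗ X) (notᵗ Y) (replace (notᵗ Y) F F) F T ⟩
  replace (notᵗ X) (notᵗ (notᵗ Y)) (notᵗ (replace (notᵗ Y) F F))
    ≡⟨ replace-assoc X F T _ _ ⟩
  replace X (notᵗ (replace (notᵗ Y) F F)) (notᵗ (notᵗ Y))
    ≡⟨ replace-cong X negated-falsified (not-involutive Y) ⟩
  orᵗ X Y ∎)
  where
  negated-falsified : notᵗ (replace (notᵗ Y) F F) ≡ replace Y T T
  negated-falsified = trans (replace-assoc (notᵗ Y) F F F T) (replace-assoc Y F T T T)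

and-assoc : ∀ X Y Z → andᵗ (andᵗ X Y) Z ≡ andᵗ X (andᵗ Y Z)
and-assoc X Y Z = begin
  andᵗ (andᵗ X Y) Z
    ≡⟨ replace-assoc X Y (replace Y F F) Z (replace Z F F) ⟩
  replace X (andᵗ Y Z) (replace (replace Y F F) Z (replace Z F F))
    ≡⟨ replace-cong X refl falsified ⟩
  andᵗ X (andᵗ Y Z) ∎
  where
  falsified : replace (replace Y F F) Z (replace Z F F) ≡ replace (andᵗ Y Z) F F
  falsified = begin
    replace (replace Y F F) Z (replace Z F F)   ≡⟨ replace-assoc Y F F Z _ ⟩
    replace Y (replace Z F F) (replace Z F F)   ≡⟨ replace-cong Y refl (sym (replace-assoc Z F F F F)) ⟩
    replace Y (replace Z F F) (replace (replace Z F F) F F)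
                                                ≡⟨ sym (replace-assoc Y Z (replace Z F F) F F) ⟩
    replace (andᵗ Y Z) F F ∎

-- (x ∧• F) ∨• y and (x ∨• T) ∧• y both evaluate x, discard its value, then evaluate y.
and-F-or : ∀ X Y → orᵗ (andᵗ X F) Y ≡ andᵗ (orᵗ X T) Y
and-F-or X Y = trans (replace-assoc X F F (replace Y T T) Y)
                     (sym (replace-assoc X T T Y (replace Y F F)))

or-and-F : ∀ X Y → orᵗ X (andᵗ Y F) ≡ andᵗ X (orᵗ Y T)
or-and-F X Y = replace-cong X (or-T-after Y) (sym (replace-assoc Y T T F F))

⟦_⟧ : {V : Set} → Term V → (V → Tree) → Tree
⟦ var v ⟧ ρ = ρ v
⟦ atom a ⟧ ρ = node T a F
⟦ `T ⟧ ρ = T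
⟦ `F ⟧ ρ = F
⟦ ¬' p ⟧ ρ = notᵗ (⟦ p ⟧ ρ)
⟦ p ∧• q ⟧ ρ = andᵗ (⟦ p ⟧ ρ) (⟦ q ⟧ ρ)
⟦ p ∨• q ⟧ ρ = orᵗ (⟦ p ⟧ ρ) (⟦ q ⟧ ρ)

⟦embed⟧ : {V : Set} (P : FT) (ρ : V → Tree) → ⟦ embed P ⟧ ρ ≡ fe P
⟦embed⟧ (var ()) ρ
⟦embed⟧ (atom a) ρ = refl
⟦embed⟧ `T ρ = refl
⟦embed⟧ `F ρ = refl
⟦embed⟧ (¬' p) ρ = cong notᵗ (⟦embed⟧ p ρ)
⟦embed⟧ (p ∧• q) ρ = cong₂ andᵗ (⟦embed⟧ p ρ) (⟦embed⟧ q ρ)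
⟦embed⟧ (p ∨• q) ρ = cong₂ orᵗ (⟦embed⟧ p ρ) (⟦embed⟧ q ρ)

⟦subst⟧ : {V W : Set} (σ : V → Term W) (t : Term V) (ρ : W → Tree) →
          ⟦ subst σ t ⟧ ρ ≡ ⟦ t ⟧ (λ v → ⟦ σ v ⟧ ρ)
⟦subst⟧ σ (var v) ρ = refl
⟦subst⟧ σ (atom a) ρ = refl
⟦subst⟧ σ `T ρ = refl
⟦subst⟧ σ `F ρ = refl
⟦subst⟧ σ (¬' p) ρ = cong notᵗ (⟦subst⟧ σ p ρ)
⟦subst⟧ σ (p ∧• q) ρ = cong₂ andᵗ (⟦subst⟧ σ p ρ) (⟦subst⟧ σ q ρ)
⟦subst⟧ σ (p ∨• q) ρ = cong₂ orᵗ (⟦subst⟧ σ p ρ) (⟦subst⟧ σ q ρ)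

axiom-sound : ∀ {l r} → Axiom l r → (ρ : Fin 3 → Tree) → ⟦ l ⟧ ρ ≡ ⟦ r ⟧ ρ
axiom-sound ax1  ρ = refl
axiom-sound ax2  ρ = de-morgan (ρ zero) (ρ (suc zero))
axiom-sound ax3  ρ = not-involutive (ρ zero)
axiom-sound ax4  ρ = and-assoc (ρ zero) (ρ (suc zero)) (ρ (suc (suc zero)))
axiom-sound ax5  ρ = refl
axiom-sound ax6  ρ = replace-identity (ρ zero)
axiom-sound ax7  ρ = refl
axiom-sound ax8  ρ = sym (and-F-not (ρ zero))
axiom-sound ax9  ρ = and-F-or (ρ zero) (ρ (suc zero))
axiom-sound ax10 ρ = or-and-F (ρ zero) (ρ (suc zero))

sound : {V : Set} {s t : Term V} → V ⊢ s ≈ t → (ρ : V → Tree) → ⟦ s ⟧ ρ ≡ ⟦ t ⟧ ρ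
sound refl' ρ = refl
sound (sym' d) ρ = sym (sound d ρ)
sound (trans' d e) ρ = trans (sound d ρ) (sound e ρ)
sound (inst {l} {r} a σ) ρ = begin
  ⟦ subst σ l ⟧ ρ               ≡⟨ ⟦subst⟧ σ l ρ ⟩
  ⟦ l ⟧ (λ v → ⟦ σ v ⟧ ρ)       ≡⟨ axiom-sound a (λ v → ⟦ σ v ⟧ ρ) ⟩
  ⟦ r ⟧ (λ v → ⟦ σ v ⟧ ρ)       ≡⟨ sym (⟦subst⟧ σ r ρ) ⟩
  ⟦ subst σ r ⟧ ρ ∎
sound (cong¬ d) ρ = cong notᵗ (sound d ρ)
sound (cong∧ d e) ρ = cong₂ andᵗ (sound d ρ) (sound e ρ)
sound (cong∨ d e) ρ = cong₂ orᵗ (sound d ρ) (sound e ρ)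

mainTheorem1 : (P Q : FT) (V : Set) → V ⊢ embed P ≈ embed Q → fe P ≡ fe Q
mainTheorem1 P Q V d = begin
  fe P               ≡⟨ sym (⟦embed⟧ P ρ) ⟩
  ⟦ embed P ⟧ ρ      ≡⟨ sound d ρ ⟩
  ⟦ embed Q ⟧ ρ      ≡⟨ ⟦embed⟧ Q ρ ⟩
  fe Q ∎
  where
  -- Any valuation will do; the variables do not occur in closed terms.
  ρ : V → Tree
  ρ _ = T
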